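{- For every integer $s \ge 1$, \[ \limsup_{n\to\infty} \frac{\alpha_s(H_2(n))}{2^n/n} = s-1. \]
   Context: $H_2(n)$ is the graph with vertex set $\{0,1\}^n$ in which $x,y$ are adjacent iff their Hamming distance $|\{i : x_i\ne y_i\}|$ is exactly $2$. For a graph $G$, $\alpha_s(G)$ denotes the maximum size of a vertex set $S\subseteq V(G)$ such that the induced subgraph $G[S]$ contains no copy of $K_s$. -}

module Defs where

open import Data.Bool using (Bool; true; false)
open import Data.Nat using (ℕ; zero; suc; _+_; _*_; _^_; _∸_; _≤_)
open import Data.Nat.Properties using (m^n≢0)
open import Data.Vec using (Vec; []; _∷_)
open import Data.List using (List; length)
open import Data.List.Membership.Propositional using (_∈_)
open import Data.List.Relation.Unary.All using (All)
open import Data.List.Relation.Unary.AllPairs using (AllPairs)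
open import Data.List.Relation.Unary.Unique.Propositional using (Unique)
open import Data.Product using (Σ; _×_; ∃-syntax)
open import Data.Integer using (+_)
open import Data.Rational using (ℚ; _/_)
open import Relation.Binary.PropositionalEquality using (_≡_)
open import Relation.Nullary using (¬_)

-- Vertices of H_2(n): binary words of length n.
Word : ℕ → Set
Word n = Vec Bool n

diff : Bool → Bool → ℕ
diff true  true  = 0
diff false false = 0
diff true  false = 1
diff false true  = 1

hamming : ∀ {n} → Word n → Word n → ℕ
hamming []       []       = 0
hamming (x ∷ xs) (y ∷ ys) = diff x y + hamming xs ys

-- Adjacency in H_2(n): Hamming distance exactly 2.
Adj : ∀ {n} → Word n → Word n → Set
Adj x y = hamming x y ≡ 2

HasKs : (s : ℕ) → ∀ {n} → List (Word n) → Set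
HasKs s {n} S = ∃[ C ] (length C ≡ s × Unique C × All (_∈ S) C × AllPairs Adj C)

KsFree : (s : ℕ) → ∀ {n} → List (Word n) → Set
KsFree s S = ¬ HasKs s S

-- IsAlpha s n m : m = α_s(H_2(n)), i.e. m is the maximum size of a
-- K_s-free vertex set of H_2(n).
IsAlpha : (s n m : ℕ) → Set
IsAlpha s n m =
  (∃[ S ] (Unique {A = Word n} S × KsFree s S × length S ≡ m))
  × (∀ (S : List (Word n)) → Unique S → KsFree s S → length S ≤ m)

-- The ratio  m / (2^n / n)  =  m·n / 2^n  as a rational number.
ratio : (n m : ℕ) → ℚ
ratio n m = _/_ (+ (m * n)) (2 ^ n) {{m^n≢0 2 n}}

-- Write s = t + 1. Upper bound: the n words at Hamming distance 1 from a word y are pairwise at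
-- distance 2, so a K_s-free set S contains at most t of them; counting the pairs (y, i) with
-- flipAt i y ∈ S in two ways gives |S|·n ≤ t·2ⁿ for every n.
-- Lower bound, for n = 2^k: label the coordinates bijectively by the words of length k and send x
-- to its syndrome, the xor of the labels of the coordinates where x is true. Flipping coordinate i
-- adds its label to the syndrome, so words at distance 2 have distinct syndromes and all syndrome
-- classes have the same size 2ⁿ/2^k = 2ⁿ/n. A union of t syndrome classes is therefore a K_s-free
-- set of size t·2ⁿ/n.

module Submission where

open import Defs

module Combinatorics where

  open import Algebra.Properties.CommutativeSemigroup using (interchange)
  open import Data.Bool using (Bool; true; false; not; _xor_; if_then_else_)
  import Data.Bool.Properties as Bool
  open import Data.Fin using (Fin; zero; suc)
  open import Data.Fin.Properties using (2↔Bool; *↔×)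
  import Data.Fin.Properties as Fin
  open import Data.List using (List; []; _∷_; _++_; map; filter; take; allFin; length)
  open import Data.List.Properties using (map-++; map-∘; map-cong; length-map; length-take; length-tabulate)
  open import Data.List.Membership.Propositional using (_∈_)
  open import Data.List.Membership.Propositional.Properties using (∈-filter⁻; ∈-map⁻)
  open import Data.List.Relation.Binary.Disjoint.Propositional using (Disjoint)
  open import Data.List.Relation.Binary.Subset.Propositional using (_⊆_)
  open import Data.List.Relation.Unary.All using (All; []; lookup)
  import Data.List.Relation.Unary.All.Properties as All
  open import Data.List.Relation.Unary.AllPairs using (AllPairs; []; _∷_)
  import Data.List.Relation.Unary.AllPairs as AllPairs
  import Data.List.Relation.Unary.AllPairs.Properties as AllPairsₚ
  open import Data.List.Relation.Unary.Any using (any?)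
  open import Data.List.Relation.Unary.Unique.Propositional using (Unique)
  import Data.List.Relation.Unary.Unique.Propositional.Properties as Unique
  open import Data.Nat using (ℕ; zero; suc; _+_; _*_; _^_; _≤_; _<_; z≤n; s≤s⁻¹; _≤?_)
  open import Data.Nat.ListAction using (sum)
  open import Data.Nat.ListAction.Properties using (sum-++)
  open import Data.Nat.Properties hiding (_≟_)
  open import Data.Product using (_×_; _,_; proj₂; ∃-syntax; uncurry)
  import Data.Product as Product
  open import Data.Product.Function.NonDependent.Propositional using (_×-↔_)
  open import Data.Vec using ([]; _∷_; zipWith; replicate; updateAt)
  open import Data.Vec.Properties
    using (≡-dec; ∷-injectiveʳ; zipWith-assoc; zipWith-comm; zipWith-identityˡ; zipWith-identityʳ)
  open import Function using (_∘_; id; _↔_; mk↔ₛ′; Inverse; Injection)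
  open import Function.Construct.Composition using (_↔-∘_)
  open import Function.Properties.Inverse using (↔⇒↣)
  open import Relation.Binary.Definitions using (DecidableEquality)
  open import Relation.Binary.PropositionalEquality
    using (_≡_; _≢_; refl; sym; trans; cong; cong₂; subst; module ≡-Reasoning)
  open import Relation.Nullary using (Dec; does; yes; no; ¬_; contradiction)
  open import Relation.Nullary.Decidable using (dec-true; dec-false)
  open import Relation.Unary using (Decidable)

  variable
    k n s : ℕ

  -- Defined through `does` alone, so that `[ a ∷ x ≟ b ∷ y ]` reduces to `[ x ≟ y ]` or to 0 for
  -- constructors a and b; this makes `∑-point` a computation.
  [_] : {P : Set} → Dec P → ℕ
  [ P? ] = if does P? then 1 else 0

  []-yes : {P : Set} (P? : Dec P) → P → [ P? ] ≡ 1
  []-yes P? p rewrite dec-true P? p = refl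

  []-no : {P : Set} (P? : Dec P) → ¬ P → [ P? ] ≡ 0
  []-no P? ¬p rewrite dec-false P? ¬p = refl

  []-mono-≤ : {P Q : Set} (P? : Dec P) (Q? : Dec Q) → (P → Q) → [ P? ] ≤ [ Q? ]
  []-mono-≤ (yes p) Q? P→Q = ≤-reflexive (sym ([]-yes Q? (P→Q p)))
  []-mono-≤ (no _)  _  _   = z≤n

  []-cong : {P Q : Set} (P? : Dec P) (Q? : Dec Q) → (P → Q) → (Q → P) → [ P? ] ≡ [ Q? ]
  []-cong P? Q? P→Q Q→P = ≤-antisym ([]-mono-≤ P? Q? P→Q) ([]-mono-≤ Q? P? Q→P)

  sum-map-const : {A : Set} (c : ℕ) (xs : List A) → sum (map (λ _ → c) xs) ≡ length xs * c
  sum-map-const c []       = refl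
  sum-map-const c (x ∷ xs) = cong (c +_) (sum-map-const c xs)

  length-filter≡sum : {A : Set} {P : A → Set} (P? : Decidable P) (xs : List A) →
                      length (filter P? xs) ≡ sum (map (λ x → [ P? x ]) xs)
  length-filter≡sum P? []       = refl
  length-filter≡sum P? (x ∷ xs) with does (P? x)
  ... | true  = cong suc (length-filter≡sum P? xs)
  ... | false = length-filter≡sum P? xs

  infix 4 _≟_ _∈?_

  _≟_ : DecidableEquality (Word n)
  _≟_ = ≡-dec Bool._≟_

  _∈?_ : (x : Word n) (xs : List (Word n)) → Dec (x ∈ xs)
  x ∈? xs = any? (x ≟_) xs

  [∈?]-∷ : {x y : Word n} {xs : List (Word n)} → All (x ≢_) xs →
           [ y ∈? x ∷ xs ] ≡ [ y ≟ x ] + [ y ∈? xs ]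
  -- `y ∈? x ∷ xs` is computed from `y ≟ x`, so this match also evaluates the left-hand side.
  [∈?]-∷ {x = x} {y} {xs} x∉xs with y ≟ x
  ... | yes refl = cong suc (sym ([]-no (y ∈? xs) (λ y∈xs → lookup x∉xs y∈xs refl)))
  ... | no _     = refl

  [∈?]≡sum : {y : Word n} {xs : List (Word n)} → Unique xs →
             [ y ∈? xs ] ≡ sum (map (λ x → [ y ≟ x ]) xs)
  [∈?]≡sum []           = refl
  [∈?]≡sum {y = y} {x ∷ xs} (x∉xs ∷ u) =
    trans ([∈?]-∷ x∉xs) (cong ([ y ≟ x ] +_) ([∈?]≡sum u))

  infixl 6 _⊕_

  _⊕_ : Word n → Word n → Word n
  _⊕_ = zipWith _xor_

  ⊕-assoc : (x y z : Word n) → (x ⊕ y) ⊕ z ≡ x ⊕ (y ⊕ z)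
  ⊕-assoc = zipWith-assoc Bool.xor-assoc

  ⊕-comm : (x y : Word n) → x ⊕ y ≡ y ⊕ x
  ⊕-comm = zipWith-comm Bool.xor-comm

  ⊕-self : (x : Word n) → x ⊕ x ≡ replicate n false
  ⊕-self []      = refl
  ⊕-self (b ∷ x) = cong₂ _∷_ (Bool.xor-same b) (⊕-self x)

  ⊕-involutiveʳ : (x y : Word n) → x ⊕ y ⊕ y ≡ x
  ⊕-involutiveʳ x y = begin
    x ⊕ y ⊕ y                ≡⟨ ⊕-assoc x y y ⟩
    x ⊕ (y ⊕ y)              ≡⟨ cong (x ⊕_) (⊕-self y) ⟩
    x ⊕ replicate _ false    ≡⟨ zipWith-identityʳ Bool.xor-identityʳ x ⟩
    x                        ∎
    where open ≡-Reasoning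

  ⊕-involutiveˡ : (x y : Word n) → x ⊕ (x ⊕ y) ≡ y
  ⊕-involutiveˡ x y = begin
    x ⊕ (x ⊕ y)              ≡⟨ ⊕-assoc x x y ⟨
    x ⊕ x ⊕ y                ≡⟨ cong (_⊕ y) (⊕-self x) ⟩
    replicate _ false ⊕ y    ≡⟨ zipWith-identityˡ Bool.xor-identityˡ y ⟩
    y                        ∎
    where open ≡-Reasoning

  ⊕-cancelʳ : {x y z : Word n} → x ⊕ z ≡ y ⊕ z → x ≡ y
  ⊕-cancelʳ {x = x} {y} {z} e =
    trans (sym (⊕-involutiveʳ x z)) (trans (cong (_⊕ z) e) (⊕-involutiveʳ y z))

  ⊕-cancelˡ : {x y z : Word n} → z ⊕ x ≡ z ⊕ y → x ≡ y
  ⊕-cancelˡ {x = x} {y} {z} e =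
    trans (sym (⊕-involutiveˡ z x)) (trans (cong (z ⊕_) e) (⊕-involutiveˡ z y))

  flipAt : Fin n → Word n → Word n
  flipAt i x = updateAt x i not

  hamming-refl : (x : Word n) → hamming x x ≡ 0
  hamming-refl []          = refl
  hamming-refl (true ∷ x)  = hamming-refl x
  hamming-refl (false ∷ x) = hamming-refl x

  hamming-comm : (x y : Word n) → hamming x y ≡ hamming y x
  hamming-comm []          []          = refl
  hamming-comm (true ∷ x)  (true ∷ y)  = hamming-comm x y
  hamming-comm (true ∷ x)  (false ∷ y) = cong suc (hamming-comm x y)
  hamming-comm (false ∷ x) (true ∷ y)  = cong suc (hamming-comm x y)
  hamming-comm (false ∷ x) (false ∷ y) = hamming-comm x y

  hamming-flipAt : (i : Fin n) (x : Word n) → hamming x (flipAt i x) ≡ 1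
  hamming-flipAt zero    (true ∷ x)  = cong suc (hamming-refl x)
  hamming-flipAt zero    (false ∷ x) = cong suc (hamming-refl x)
  hamming-flipAt (suc i) (true ∷ x)  = hamming-flipAt i x
  hamming-flipAt (suc i) (false ∷ x) = hamming-flipAt i x

  hamming-flipAtˡ : (i : Fin n) (x : Word n) → hamming (flipAt i x) x ≡ 1
  hamming-flipAtˡ i x = trans (hamming-comm (flipAt i x) x) (hamming-flipAt i x)

  flipAt-adjacent : (i j : Fin n) (x : Word n) → i ≢ j → Adj (flipAt i x) (flipAt j x)
  flipAt-adjacent zero    zero    x           i≢j = contradiction refl i≢j
  flipAt-adjacent zero    (suc j) (true ∷ x)  _   = cong suc (hamming-flipAt j x)
  flipAt-adjacent zero    (suc j) (false ∷ x) _   = cong suc (hamming-flipAt j x)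
  flipAt-adjacent (suc i) zero    (true ∷ x)  _   = cong suc (hamming-flipAtˡ i x)
  flipAt-adjacent (suc i) zero    (false ∷ x) _   = cong suc (hamming-flipAtˡ i x)
  flipAt-adjacent (suc i) (suc j) (true ∷ x)  i≢j = flipAt-adjacent i j x (i≢j ∘ cong suc)
  flipAt-adjacent (suc i) (suc j) (false ∷ x) i≢j = flipAt-adjacent i j x (i≢j ∘ cong suc)

  Adj-irrefl : {x y : Word n} → Adj x y → x ≢ y
  Adj-irrefl {x = x} adj refl = 0≢1+n (trans (sym (hamming-refl x)) adj)

  hamming≡0⇒≡ : (x y : Word n) → hamming x y ≡ 0 → x ≡ y
  hamming≡0⇒≡ []          []          _ = refl
  hamming≡0⇒≡ (true ∷ x)  (true ∷ y)  h = cong (true ∷_) (hamming≡0⇒≡ x y h)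
  hamming≡0⇒≡ (false ∷ x) (false ∷ y) h = cong (false ∷_) (hamming≡0⇒≡ x y h)
  hamming≡0⇒≡ (true ∷ x)  (false ∷ y) ()
  hamming≡0⇒≡ (false ∷ x) (true ∷ y)  ()

  hamming≡1⇒flipAt : (x y : Word n) → hamming x y ≡ 1 → ∃[ i ] flipAt i x ≡ y
  hamming≡1⇒flipAt []          []          ()
  hamming≡1⇒flipAt (true ∷ x)  (true ∷ y)  h =
    Product.map suc (cong (true ∷_)) (hamming≡1⇒flipAt x y h)
  hamming≡1⇒flipAt (false ∷ x) (false ∷ y) h =
    Product.map suc (cong (false ∷_)) (hamming≡1⇒flipAt x y h)
  hamming≡1⇒flipAt (true ∷ x)  (false ∷ y) h =
    zero , cong (false ∷_) (hamming≡0⇒≡ x y (suc-injective h))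
  hamming≡1⇒flipAt (false ∷ x) (true ∷ y)  h =
    zero , cong (true ∷_) (hamming≡0⇒≡ x y (suc-injective h))

  Adj⇒common-neighbour : (x y : Word n) → Adj x y →
                         ∃[ i ] ∃[ j ] (i ≢ j × flipAt i x ≡ flipAt j y)
  Adj⇒common-neighbour []          []          ()
  Adj⇒common-neighbour (true ∷ x)  (true ∷ y)  adj with Adj⇒common-neighbour x y adj
  ... | i , j , i≢j , e = suc i , suc j , i≢j ∘ Fin.suc-injective , cong (true ∷_) e
  Adj⇒common-neighbour (false ∷ x) (false ∷ y) adj with Adj⇒common-neighbour x y adj
  ... | i , j , i≢j , e = suc i , suc j , i≢j ∘ Fin.suc-injective , cong (false ∷_) e
  Adj⇒common-neighbour (true ∷ x)  (false ∷ y) adj with hamming≡1⇒flipAt x y (suc-injective adj)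
  ... | i , e = suc i , zero , (λ ()) , cong (true ∷_) e
  Adj⇒common-neighbour (false ∷ x) (true ∷ y)  adj with hamming≡1⇒flipAt x y (suc-injective adj)
  ... | i , e = suc i , zero , (λ ()) , cong (false ∷_) e

  ∑ : ∀ n → (Word n → ℕ) → ℕ
  ∑ zero    f = f []
  ∑ (suc n) f = ∑ n (f ∘ (true ∷_)) + ∑ n (f ∘ (false ∷_))

  ∑-cong : ∀ n {f g : Word n → ℕ} → (∀ x → f x ≡ g x) → ∑ n f ≡ ∑ n g
  ∑-cong zero    f≗g = f≗g []
  ∑-cong (suc n) f≗g =
    cong₂ _+_ (∑-cong n (f≗g ∘ (true ∷_))) (∑-cong n (f≗g ∘ (false ∷_)))

  ∑-mono-≤ : ∀ n {f g : Word n → ℕ} → (∀ x → f x ≤ g x) → ∑ n f ≤ ∑ n g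
  ∑-mono-≤ zero    f≤g = f≤g []
  ∑-mono-≤ (suc n) f≤g =
    +-mono-≤ (∑-mono-≤ n (f≤g ∘ (true ∷_))) (∑-mono-≤ n (f≤g ∘ (false ∷_)))

  ∑-distrib-+ : ∀ n (f g : Word n → ℕ) → ∑ n (λ x → f x + g x) ≡ ∑ n f + ∑ n g
  ∑-distrib-+ zero    f g = refl
  ∑-distrib-+ (suc n) f g =
    trans (cong₂ _+_ (∑-distrib-+ n (f ∘ (true ∷_)) (g ∘ (true ∷_)))
                     (∑-distrib-+ n (f ∘ (false ∷_)) (g ∘ (false ∷_))))
          (interchange +-commutativeSemigroup (∑ n (f ∘ (true ∷_))) _ _ _)

  ∑-const : ∀ n c → ∑ n (λ _ → c) ≡ c * 2 ^ n
  ∑-const zero    c = sym (*-identityʳ c)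
  ∑-const (suc n) c = begin
    ∑ n (λ _ → c) + ∑ n (λ _ → c)   ≡⟨ cong₂ _+_ (∑-const n c) (∑-const n c) ⟩
    c * 2 ^ n + c * 2 ^ n           ≡⟨ cong (λ m → c * 2 ^ n + c * m) (+-identityʳ (2 ^ n)) ⟨
    c * 2 ^ n + c * (2 ^ n + 0)     ≡⟨ *-distribˡ-+ c (2 ^ n) (2 ^ n + 0) ⟨
    c * 2 ^ suc n                   ∎
    where open ≡-Reasoning

  ∑-flipAt : ∀ n (i : Fin n) (f : Word n → ℕ) → ∑ n (f ∘ flipAt i) ≡ ∑ n f
  ∑-flipAt (suc n) zero    f = +-comm (∑ n (f ∘ (false ∷_))) (∑ n (f ∘ (true ∷_)))
  ∑-flipAt (suc n) (suc i) f =
    cong₂ _+_ (∑-flipAt n i (f ∘ (true ∷_))) (∑-flipAt n i (f ∘ (false ∷_)))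

  ∑-comm : ∀ m n (F : Word m → Word n → ℕ) →
           ∑ m (λ x → ∑ n (F x)) ≡ ∑ n (λ y → ∑ m (λ x → F x y))
  ∑-comm m zero    F = refl
  ∑-comm m (suc n) F =
    trans (∑-distrib-+ m (λ x → ∑ n (F x ∘ (true ∷_))) (λ x → ∑ n (F x ∘ (false ∷_))))
          (cong₂ _+_ (∑-comm m n (λ x → F x ∘ (true ∷_))) (∑-comm m n (λ x → F x ∘ (false ∷_))))

  ∑-sum-comm : ∀ n {A : Set} (F : Word n → A → ℕ) (as : List A) →
               ∑ n (λ x → sum (map (F x) as)) ≡ sum (map (λ a → ∑ n (λ x → F x a)) as)
  ∑-sum-comm n F []       = ∑-const n 0
  ∑-sum-comm n F (a ∷ as) =
    trans (∑-distrib-+ n (λ x → F x a) (λ x → sum (map (F x) as)))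
          (cong (∑ n (λ x → F x a) +_) (∑-sum-comm n F as))

  ∑-point : (x : Word n) → ∑ n (λ y → [ x ≟ y ]) ≡ 1
  ∑-point             []          = refl
  ∑-point {n = suc n} (true ∷ x)  = cong₂ _+_ (∑-point x) (∑-const n 0)
  ∑-point {n = suc n} (false ∷ x) = cong₂ _+_ (∑-const n 0) (∑-point x)

  ∑-∈ : {S : List (Word n)} → Unique S → ∑ n (λ y → [ y ∈? S ]) ≡ length S
  ∑-∈ {n} {S} S! = begin
    ∑ n (λ y → [ y ∈? S ])                      ≡⟨ ∑-cong n (λ y → [∈?]≡sum S!) ⟩
    ∑ n (λ y → sum (map (λ x → [ y ≟ x ]) S))   ≡⟨ ∑-sum-comm n (λ y x → [ y ≟ x ]) S ⟩
    sum (map (λ x → ∑ n (λ y → [ y ≟ x ])) S)  ≡⟨ cong sum (map-cong ∑-point′ S) ⟩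
    sum (map (λ _ → 1) S)                        ≡⟨ sum-map-const 1 S ⟩
    length S * 1                                 ≡⟨ *-identityʳ (length S) ⟩
    length S                                     ∎
    where
    open ≡-Reasoning
    ∑-point′ : (x : Word n) → ∑ n (λ y → [ y ≟ x ]) ≡ 1
    ∑-point′ x = trans (∑-cong n (λ y → []-cong (y ≟ x) (x ≟ y) sym sym)) (∑-point x)

  Unique-⊆⇒length-≤ : {xs ys : List (Word n)} → Unique xs → Unique ys → xs ⊆ ys →
                      length xs ≤ length ys
  Unique-⊆⇒length-≤ {n} {xs} {ys} xs! ys! xs⊆ys = begin
    length xs                ≡⟨ ∑-∈ xs! ⟨
    ∑ n (λ w → [ w ∈? xs ])  ≤⟨ ∑-mono-≤ n (λ w → []-mono-≤ (w ∈? xs) (w ∈? ys) xs⊆ys) ⟩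
    ∑ n (λ w → [ w ∈? ys ])  ≡⟨ ∑-∈ ys! ⟩
    length ys                ∎
    where open ≤-Reasoning

  clique-length< : {S C : List (Word n)} → KsFree s S → All (_∈ S) C → AllPairs Adj C →
                   length C < s
  clique-length< {s = s} {C = C} free C⊆S clique with s ≤? length C
  ... | no  s≰|C| = ≰⇒> s≰|C|
  ... | yes s≤|C| = contradiction
    ( take s C
    , trans (length-take s C) (m≤n⇒m⊓n≡m s≤|C|)
    , Unique.take⁺ s (AllPairs.map Adj-irrefl clique)
    , All.take⁺ s C⊆S
    , AllPairsₚ.take⁺ s clique )
    free

  neighbours : Word n → List (Word n)
  neighbours {n} y = map (λ i → flipAt i y) (allFin n)

  neighbours-clique : (y : Word n) → AllPairs Adj (neighbours y)
  neighbours-clique {n} y =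
    AllPairsₚ.map⁺ (AllPairs.map (λ {i} {j} → flipAt-adjacent i j y) (Unique.allFin⁺ n))

  neighbourhood-bound : {S : List (Word n)} → KsFree (suc s) S → (y : Word n) →
                        sum (map (λ z → [ z ∈? S ]) (neighbours y)) ≤ s
  neighbourhood-bound {s = s} {S} free y = begin
    sum (map (λ z → [ z ∈? S ]) (neighbours y))  ≡⟨ length-filter≡sum (_∈? S) (neighbours y) ⟨
    length (filter (_∈? S) (neighbours y))       ≤⟨ s≤s⁻¹ (clique-length< free in-S clique) ⟩
    s                                            ∎
    where
    open ≤-Reasoning
    in-S : All (_∈ S) (filter (_∈? S) (neighbours y))
    in-S = All.all-filter (_∈? S) (neighbours y)
    clique : AllPairs Adj (filter (_∈? S) (neighbours y))
    clique = AllPairsₚ.filter⁺ (_∈? S) (neighbours-clique y)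

  KsFree-upper-bound : {S : List (Word n)} → Unique S → KsFree (suc s) S →
                       length S * n ≤ s * 2 ^ n
  KsFree-upper-bound {n} {s} {S} S! free = begin
    length S * n
      ≡⟨ *-comm (length S) n ⟩
    n * length S
      ≡⟨ cong (_* length S) (length-tabulate {n = n} id) ⟨
    length (allFin n) * length S
      ≡⟨ sum-map-const (length S) (allFin n) ⟨
    sum (map (λ _ → length S) (allFin n))
      ≡⟨ cong sum (map-cong count-flipped (allFin n)) ⟩
    sum (map (λ i → ∑ n (λ y → [ flipAt i y ∈? S ])) (allFin n))
      ≡⟨ ∑-sum-comm n (λ y i → [ flipAt i y ∈? S ]) (allFin n) ⟨
    ∑ n (λ y → sum (map (λ i → [ flipAt i y ∈? S ]) (allFin n)))
      ≡⟨ ∑-cong n (λ y → cong sum (map-∘ (allFin n))) ⟩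
    ∑ n (λ y → sum (map (λ z → [ z ∈? S ]) (neighbours y)))
      ≤⟨ ∑-mono-≤ n (neighbourhood-bound free) ⟩
    ∑ n (λ _ → s)
      ≡⟨ ∑-const n s ⟩
    s * 2 ^ n
      ∎
    where
    open ≤-Reasoning
    count-flipped : (i : Fin n) → length S ≡ ∑ n (λ y → [ flipAt i y ∈? S ])
    count-flipped i = sym (trans (∑-flipAt n i (λ y → [ y ∈? S ])) (∑-∈ S!))

  ProperColouring : {A : Set} → (Word n → A) → Set
  ProperColouring φ = ∀ x y → Adj x y → φ x ≢ φ y

  syndrome : (Fin n → Word k) → Word n → Word k
  syndrome {k = k} h []          = replicate k false
  syndrome         h (true ∷ x)  = h zero ⊕ syndrome (h ∘ suc) x
  syndrome         h (false ∷ x) = syndrome (h ∘ suc) x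

  syndrome-flipAt : (h : Fin n → Word k) (i : Fin n) (x : Word n) →
                    syndrome h (flipAt i x) ≡ syndrome h x ⊕ h i
  syndrome-flipAt h zero    (true ∷ x)  =
    sym (trans (cong (_⊕ h zero) (⊕-comm (h zero) _)) (⊕-involutiveʳ _ (h zero)))
  syndrome-flipAt h zero    (false ∷ x) = ⊕-comm (h zero) _
  syndrome-flipAt h (suc i) (true ∷ x)  =
    trans (cong (h zero ⊕_) (syndrome-flipAt (h ∘ suc) i x)) (sym (⊕-assoc (h zero) _ _))
  syndrome-flipAt h (suc i) (false ∷ x) = syndrome-flipAt (h ∘ suc) i x

  syndrome-proper : (h : Fin n → Word k) → (∀ {i j} → h i ≡ h j → i ≡ j) →
                    ProperColouring (syndrome h)
  syndrome-proper h h-injective x y adj same with Adj⇒common-neighbour x y adj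
  ... | i , j , i≢j , x+i≡y+j = i≢j (h-injective (⊕-cancelˡ (begin
    syndrome h x ⊕ h i        ≡⟨ syndrome-flipAt h i x ⟨
    syndrome h (flipAt i x)   ≡⟨ cong (syndrome h) x+i≡y+j ⟩
    syndrome h (flipAt j y)   ≡⟨ syndrome-flipAt h j y ⟩
    syndrome h y ⊕ h j        ≡⟨ cong (_⊕ h j) same ⟨
    syndrome h x ⊕ h j        ∎)))
    where open ≡-Reasoning

  fibreSize : (Fin n → Word k) → Word k → ℕ
  fibreSize {n} h v = ∑ n (λ x → [ syndrome h x ≟ v ])

  fibreSize-shift : (h : Fin n → Word k) (v : Word k) (i : Fin n) →
                    fibreSize h (v ⊕ h i) ≡ fibreSize h v
  fibreSize-shift {n} h v i = begin
    ∑ n (λ x → [ syndrome h x ≟ v ⊕ h i ])              ≡⟨ ∑-flipAt n i _ ⟨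
    ∑ n (λ x → [ syndrome h (flipAt i x) ≟ v ⊕ h i ])   ≡⟨ ∑-cong n shift ⟩
    ∑ n (λ x → [ syndrome h x ≟ v ])                     ∎
    where
    open ≡-Reasoning
    shift : ∀ x → [ syndrome h (flipAt i x) ≟ v ⊕ h i ] ≡ [ syndrome h x ≟ v ]
    shift x rewrite syndrome-flipAt h i x =
      []-cong (syndrome h x ⊕ h i ≟ v ⊕ h i) (syndrome h x ≟ v) ⊕-cancelʳ (cong (_⊕ h i))

  fibreSize-constant : (h : Fin n → Word k) → (∀ w → ∃[ i ] h i ≡ w) →
                       (u w : Word k) → fibreSize h u ≡ fibreSize h w
  fibreSize-constant h h-onto u w with h-onto (u ⊕ w)
  ... | i , hi≡u+w = begin
    fibreSize h u              ≡⟨ fibreSize-shift h u i ⟨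
    fibreSize h (u ⊕ h i)      ≡⟨ cong (λ z → fibreSize h (u ⊕ z)) hi≡u+w ⟩
    fibreSize h (u ⊕ (u ⊕ w))  ≡⟨ cong (fibreSize h) (⊕-involutiveˡ u w) ⟩
    fibreSize h w              ∎
    where open ≡-Reasoning

  fibreSize*2^k≡2^n : (h : Fin n → Word k) → (∀ w → ∃[ i ] h i ≡ w) →
                      (u : Word k) → fibreSize h u * 2 ^ k ≡ 2 ^ n
  fibreSize*2^k≡2^n {n} {k} h h-onto u = begin
    fibreSize h u * 2 ^ k                          ≡⟨ ∑-const k (fibreSize h u) ⟨
    ∑ k (λ _ → fibreSize h u)                      ≡⟨ ∑-cong k (fibreSize-constant h h-onto u) ⟩
    ∑ k (λ v → ∑ n (λ x → [ syndrome h x ≟ v ]))   ≡⟨ ∑-comm k n (λ v x → [ syndrome h x ≟ v ]) ⟩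
    ∑ n (λ x → ∑ k (λ v → [ syndrome h x ≟ v ]))   ≡⟨ ∑-cong n (λ x → ∑-point (syndrome h x)) ⟩
    ∑ n (λ _ → 1)                                  ≡⟨ ∑-const n 1 ⟩
    1 * 2 ^ n                                      ≡⟨ *-identityˡ (2 ^ n) ⟩
    2 ^ n                                          ∎
    where open ≡-Reasoning

  sum-map-fibreSize : (h : Fin n → Word k) → (∀ w → ∃[ i ] h i ≡ w) →
                      (vs : List (Word k)) → sum (map (fibreSize h) vs) * 2 ^ k ≡ length vs * 2 ^ n
  sum-map-fibreSize         h h-onto []       = refl
  sum-map-fibreSize {k = k} h h-onto (v ∷ vs) =
    trans (*-distribʳ-+ (2 ^ k) (fibreSize h v) (sum (map (fibreSize h) vs)))
          (cong₂ _+_ (fibreSize*2^k≡2^n h h-onto v) (sum-map-fibreSize h h-onto vs))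

  allWords : ∀ n → List (Word n)
  allWords zero    = [] ∷ []
  allWords (suc n) = map (true ∷_) (allWords n) ++ map (false ∷_) (allWords n)

  allWords-unique : ∀ n → Unique (allWords n)
  allWords-unique zero    = [] ∷ []
  allWords-unique (suc n) =
    Unique.++⁺ (Unique.map⁺ ∷-injectiveʳ (allWords-unique n))
               (Unique.map⁺ ∷-injectiveʳ (allWords-unique n))
               heads-differ
    where
    heads-differ : Disjoint (map (true ∷_) (allWords n)) (map (false ∷_) (allWords n))
    heads-differ (t∈ , f∈) with ∈-map⁻ (true ∷_) t∈ | ∈-map⁻ (false ∷_) f∈
    ... | _ , _ , refl | _ , _ , ()

  sum-map-allWords : ∀ n (f : Word n → ℕ) → sum (map f (allWords n)) ≡ ∑ n f
  sum-map-allWords zero    f = +-identityʳ (f [])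
  sum-map-allWords (suc n) f = begin
    sum (map f (map (true ∷_) W ++ map (false ∷_) W))
      ≡⟨ cong sum (map-++ f (map (true ∷_) W) _) ⟩
    sum (map f (map (true ∷_) W) ++ map f (map (false ∷_) W))
      ≡⟨ sum-++ (map f (map (true ∷_) W)) _ ⟩
    sum (map f (map (true ∷_) W)) + sum (map f (map (false ∷_) W))
      ≡⟨ cong₂ _+_ (cong sum (map-∘ W)) (cong sum (map-∘ W)) ⟨
    sum (map (f ∘ (true ∷_)) W) + sum (map (f ∘ (false ∷_)) W)
      ≡⟨ cong₂ _+_ (sum-map-allWords n (f ∘ (true ∷_))) (sum-map-allWords n (f ∘ (false ∷_))) ⟩
    ∑ (suc n) f
      ∎
    where
    open ≡-Reasoning
    W : List (Word n)
    W = allWords n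

  length-allWords : ∀ n → length (allWords n) ≡ 2 ^ n
  length-allWords n = begin
    length (allWords n)               ≡⟨ *-identityʳ _ ⟨
    length (allWords n) * 1           ≡⟨ sum-map-const 1 (allWords n) ⟨
    sum (map (λ _ → 1) (allWords n))  ≡⟨ sum-map-allWords n (λ _ → 1) ⟩
    ∑ n (λ _ → 1)                     ≡⟨ ∑-const n 1 ⟩
    1 * 2 ^ n                         ≡⟨ *-identityˡ (2 ^ n) ⟩
    2 ^ n                             ∎
    where open ≡-Reasoning

  preimage : (Word n → Word k) → List (Word k) → List (Word n)
  preimage {n} φ vs = filter (λ x → φ x ∈? vs) (allWords n)

  preimage-unique : (φ : Word n → Word k) (vs : List (Word k)) → Unique (preimage φ vs)
  preimage-unique {n} φ vs = Unique.filter⁺ (λ x → φ x ∈? vs) (allWords-unique n)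

  preimage-KsFree : {φ : Word n → Word k} → ProperColouring φ →
                    {vs : List (Word k)} → Unique vs → length vs < s → KsFree s (preimage φ vs)
  preimage-KsFree {n} {s = s} {φ} φ-proper {vs} vs! |vs|<s (C , |C|≡s , _ , C⊆S , clique) =
    <⇒≱ |vs|<s (begin
      s                ≡⟨ |C|≡s ⟨
      length C         ≡⟨ length-map φ C ⟨
      length (map φ C) ≤⟨ Unique-⊆⇒length-≤ φ[C]-unique vs! φ[C]⊆vs ⟩
      length vs        ∎)
    where
    open ≤-Reasoning
    φ[C]-unique : Unique (map φ C)
    φ[C]-unique = AllPairsₚ.map⁺ (AllPairs.map (λ {x} {y} → φ-proper x y) clique)
    φ[C]⊆vs : map φ C ⊆ vs
    φ[C]⊆vs v∈φ[C] with ∈-map⁻ φ v∈φ[C]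
    ... | x , x∈C , refl =
      proj₂ (∈-filter⁻ (λ x → φ x ∈? vs) {xs = allWords n} (lookup C⊆S x∈C))

  length-preimage-syndrome : (h : Fin n → Word k) {vs : List (Word k)} → Unique vs →
                             length (preimage (syndrome h) vs) ≡ sum (map (fibreSize h) vs)
  length-preimage-syndrome {n} h {vs} vs! = begin
    length (preimage (syndrome h) vs)
      ≡⟨ length-filter≡sum (λ x → syndrome h x ∈? vs) (allWords n) ⟩
    sum (map (λ x → [ syndrome h x ∈? vs ]) (allWords n))
      ≡⟨ sum-map-allWords n _ ⟩
    ∑ n (λ x → [ syndrome h x ∈? vs ])
      ≡⟨ ∑-cong n (λ x → [∈?]≡sum vs!) ⟩
    ∑ n (λ x → sum (map (λ v → [ syndrome h x ≟ v ]) vs))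
      ≡⟨ ∑-sum-comm n (λ x v → [ syndrome h x ≟ v ]) vs ⟩
    sum (map (fibreSize h) vs)
      ∎
    where open ≡-Reasoning

  Fin[2^k]↔Word : ∀ k → Fin (2 ^ k) ↔ Word k
  Fin[2^k]↔Word zero    = mk↔ₛ′ (λ _ → []) (λ _ → zero) (λ { [] → refl }) (λ { zero → refl })
  Fin[2^k]↔Word (suc k) = ∷↔ ↔-∘ ((2↔Bool ×-↔ Fin[2^k]↔Word k) ↔-∘ *↔×)
    where
    ∷↔ : (Bool × Word k) ↔ Word (suc k)
    ∷↔ = mk↔ₛ′ (uncurry _∷_) (λ { (b ∷ w) → b , w }) (λ { (b ∷ w) → refl }) (λ _ → refl)

  large-KsFree-set : ∀ k → s ≤ 2 ^ k →
    ∃[ S ] (Unique S × KsFree (suc s) S × length S * 2 ^ k ≡ s * 2 ^ (2 ^ k))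
  large-KsFree-set {s} k s≤2^k =
    preimage (syndrome h) vs , preimage-unique (syndrome h) vs ,
    preimage-KsFree h-proper vs! (≤-reflexive (cong suc |vs|≡s)) , size
    where
    h : Fin (2 ^ k) → Word k
    h = Inverse.to (Fin[2^k]↔Word k)
    h-proper : ProperColouring (syndrome h)
    h-proper = syndrome-proper h (Injection.injective (↔⇒↣ (Fin[2^k]↔Word k)))
    h-onto : ∀ w → ∃[ i ] h i ≡ w
    h-onto w = Inverse.from (Fin[2^k]↔Word k) w , Inverse.strictlyInverseˡ (Fin[2^k]↔Word k) w
    vs : List (Word k)
    vs = take s (allWords k)
    vs! : Unique vs
    vs! = Unique.take⁺ s (allWords-unique k)
    |vs|≡s : length vs ≡ s
    |vs|≡s = trans (length-take s (allWords k))
                   (m≤n⇒m⊓n≡m (subst (s ≤_) (sym (length-allWords k)) s≤2^k))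
    size : length (preimage (syndrome h) vs) * 2 ^ k ≡ s * 2 ^ (2 ^ k)
    size = begin
      length (preimage (syndrome h) vs) * 2 ^ k  ≡⟨ cong (_* 2 ^ k) (length-preimage-syndrome h vs!) ⟩
      sum (map (fibreSize h) vs) * 2 ^ k         ≡⟨ sum-map-fibreSize h h-onto vs ⟩
      length vs * 2 ^ (2 ^ k)                    ≡⟨ cong (_* 2 ^ (2 ^ k)) |vs|≡s ⟩
      s * 2 ^ (2 ^ k)                            ∎
      where open ≡-Reasoning

open import Data.Nat using (ℕ; _≥_; _∸_)
open import Data.Integer using (+_)
open import Data.Rational using (ℚ; 0ℚ; _+_; _-_; _≤_; _<_; _/_)
open import Data.Product using (_×_; ∃-syntax)

open import Data.List using (length)
open import Data.Product using (_,_)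
open import Data.Rational.Properties
  using (≤-trans; <⇒≤; +-identityʳ; +-monoʳ-≤; neg-antimono-≤; toℚᵘ-cancel-≤; toℚᵘ-fromℚᵘ)
import Data.Integer as ℤ
import Data.Integer.Properties as ℤ
import Data.Nat as ℕ
import Data.Nat.Properties as ℕ
import Data.Rational.Unnormalised as ℚᵘ
import Data.Rational.Unnormalised.Properties as ℚᵘ
open import Relation.Binary.PropositionalEquality using (refl; sym; subst; subst₂)
open Combinatorics using (KsFree-upper-bound; large-KsFree-set)

+a/d≤+c/e : ∀ a c d e .{{_ : ℕ.NonZero d}} .{{_ : ℕ.NonZero e}} →
            a ℕ.* e ℕ.≤ c ℕ.* d → + a / d ≤ + c / e
+a/d≤+c/e a c (ℕ.suc d) (ℕ.suc e) ae≤cd = toℚᵘ-cancel-≤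
  (ℚᵘ.≤-respˡ-≃ (ℚᵘ.≃-sym (toℚᵘ-fromℚᵘ (ℚᵘ.mkℚᵘ (+ a) d)))
  (ℚᵘ.≤-respʳ-≃ (ℚᵘ.≃-sym (toℚᵘ-fromℚᵘ (ℚᵘ.mkℚᵘ (+ c) e)))
    (ℚᵘ.*≤* (subst₂ ℤ._≤_ (ℤ.pos-* a (ℕ.suc e)) (ℤ.pos-* c (ℕ.suc d)) (ℤ.+≤+ ae≤cd)))))

ratio≤ : ∀ n m t → m ℕ.* n ℕ.≤ t ℕ.* 2 ℕ.^ n → ratio n m ≤ + t / 1
ratio≤ n m t mn≤t2ⁿ =
  +a/d≤+c/e (m ℕ.* n) t (2 ℕ.^ n) 1 {{ℕ.m^n≢0 2 n}}
    (ℕ.≤-trans (ℕ.≤-reflexive (ℕ.*-identityʳ (m ℕ.* n))) mn≤t2ⁿ)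

≤ratio : ∀ n m t → t ℕ.* 2 ℕ.^ n ℕ.≤ m ℕ.* n → + t / 1 ≤ ratio n m
≤ratio n m t t2ⁿ≤mn =
  +a/d≤+c/e t (m ℕ.* n) 1 (2 ℕ.^ n) {{_}} {{ℕ.m^n≢0 2 n}}
    (ℕ.≤-trans t2ⁿ≤mn (ℕ.≤-reflexive (sym (ℕ.*-identityʳ (m ℕ.* n)))))

IsAlpha⇒ratio≤ : ∀ {t n m} → IsAlpha (ℕ.suc t) n m → ratio n m ≤ + t / 1
IsAlpha⇒ratio≤ {t} {n} ((S , S! , free , refl) , _) = ratio≤ n (length S) t (KsFree-upper-bound S! free)

IsAlpha⇒ratio≥ : ∀ {t m} k → t ℕ.≤ 2 ℕ.^ k → IsAlpha (ℕ.suc t) (2 ℕ.^ k) m →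
                 + t / 1 ≤ ratio (2 ℕ.^ k) m
IsAlpha⇒ratio≥ {t} {m} k t≤2^k (_ , maximal) with large-KsFree-set k t≤2^k
... | S , S! , free , |S|2^k≡t2ⁿ =
  ≤ratio (2 ℕ.^ k) m t
    (subst (ℕ._≤ m ℕ.* 2 ℕ.^ k) |S|2^k≡t2ⁿ (ℕ.*-monoˡ-≤ (2 ℕ.^ k) (maximal S S! free)))

p≤p+q : ∀ p {q} → 0ℚ ≤ q → p ≤ p + q
p≤p+q p 0≤q = subst (_≤ p + _) (+-identityʳ p) (+-monoʳ-≤ p 0≤q)

p-q≤p : ∀ p {q} → 0ℚ ≤ q → p - q ≤ p
p-q≤p p 0≤q = subst (p - _ ≤_) (+-identityʳ p) (+-monoʳ-≤ p (neg-antimono-≤ 0≤q))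

n≤2^n : ∀ n → n ℕ.≤ 2 ℕ.^ n
n≤2^n ℕ.zero    = ℕ.z≤n
n≤2^n (ℕ.suc n) = ℕ.+-mono-≤ (ℕ.m^n>0 2 n) (ℕ.≤-trans (n≤2^n n) (ℕ.m≤m+n (2 ℕ.^ n) 0))

theorem1p5 : ∀ (s : ℕ) → s ≥ 1 →
    ∀ (α : ℕ → ℕ) → (∀ n → IsAlpha s n (α n)) →
    -- limsup_{n→∞} α n / (2^n/n) = s - 1, unfolded via ε-characterisation
    (∀ (ε : ℚ) → 0ℚ < ε →
        (∃[ N ] ∀ n → n ≥ N → ratio n (α n) ≤ (+ (s ∸ 1) / 1) + ε)
      × (∀ N → ∃[ n ] (n ≥ N × (+ (s ∸ 1) / 1) - ε ≤ ratio n (α n))))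
theorem1p5 ℕ.zero    ()
theorem1p5 (ℕ.suc t) _ α α-max ε 0<ε =
    (0 , λ n _ → ≤-trans (IsAlpha⇒ratio≤ (α-max n)) (p≤p+q _ 0≤ε))
  , λ N → let k = N ℕ.+ t in
      2 ℕ.^ k , ℕ.≤-trans (ℕ.m≤m+n N t) (n≤2^n k)
              , ≤-trans (p-q≤p _ 0≤ε) (IsAlpha⇒ratio≥ k (ℕ.≤-trans (ℕ.m≤n+m t N) (n≤2^n k)) (α-max _))
  where
  0≤ε : 0ℚ ≤ ε
  0≤ε = <⇒≤ 0<ε
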